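{- Let $G$ be a finite oriented graph and let $v_0$ be a vertex of minimum out-degree in $G$ with $d^+(v_0)=3$. Suppose that at least one out-neighbor of $v_0$ has out-degree $0$ in the induced subgraph $G[N^+(v_0)]$. Then $v_0$ is a degree-doubling node, i.e. $|N^{++}(v_0)|\ge|N^+(v_0)|$.
   Context: An oriented graph is a directed graph with no loops and at most one arc between any two vertices. $N^+(v)=\{w: v\to w\}$, $d^+(v)=|N^+(v)|$, and $N^{++}(v)=\{w: \exists x,\ v\to x\to w,\ w\notin N^+(v)\}$. $G[S]$ is the subgraph induced on the vertex set $S$. -}

module Defs where

open import Data.Nat using (ℕ)
open import Data.Bool using (Bool; true; false; _∧_; not)
open import Data.Fin using (Fin)
open import Data.Fin.Subset using (Subset; ∣_∣)
open import Data.Vec using (tabulate)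
open import Data.Vec.Functional using (foldr)
open import Relation.Binary.PropositionalEquality using (_≡_)
open import Data.Product using (_×_)
open import Relation.Nullary using (¬_)

record Digraph (n : ℕ) : Set where
  field
    arc : Fin n → Fin n → Bool

open Digraph public

IsOriented : ∀ {n} → Digraph n → Set
IsOriented {n} G = (∀ v → arc G v v ≡ false)
                 × (∀ v w → ¬ (arc G v w ≡ true × arc G w v ≡ true))

anyFin : ∀ {n} → (Fin n → Bool) → Bool
anyFin {n} p = foldr (λ b acc → b Data.Bool.∨ acc) false p

N⁺ : ∀ {n} → Digraph n → Fin n → Subset n
N⁺ G v = tabulate (λ w → arc G v w)

d⁺ : ∀ {n} → Digraph n → Fin n → ℕ
d⁺ G v = ∣ N⁺ G v ∣

N⁺⁺ : ∀ {n} → Digraph n → Fin n → Subset n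
N⁺⁺ G v = tabulate (λ w → anyFin (λ x → arc G v x ∧ arc G x w) ∧ not (arc G v w))

outDegIn : ∀ {n} → Digraph n → Subset n → Fin n → ℕ
outDegIn G S u = ∣ tabulate (λ w → Data.Vec.lookup S w ∧ arc G u w) ∣

-- If u ∈ N⁺(v₀) has no out-neighbour inside N⁺(v₀), then every out-neighbour of u
-- is reached from v₀ by a path of length two without being an out-neighbour of v₀,
-- so N⁺(u) ⊆ N⁺⁺(v₀) and |N⁺⁺(v₀)| ≥ d⁺(u) ≥ d⁺(v₀) by minimality of d⁺(v₀).
module Submission where

open import Defs
open import Data.Bool using (Bool; true; false; _∧_; not)
open import Data.Bool.Properties using (¬-not)
open import Data.Fin using (Fin; zero; suc)
open import Data.Fin.Subset using (Subset; _∈_; _∉_; _⊆_; ∣_∣; ∁; ⊤)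
open import Data.Fin.Subset.Properties
  using (p⊆q⇒∣p∣≤∣q∣; ∣p∣≡n⇒p≡⊤; ∣∁p∣≡n∸∣p∣; ∈⊤; x∈p⇒x∉∁p)
open import Data.Nat using (ℕ; _≤_; _≥_; _∸_)
open import Data.Nat.Properties using (≤-trans)
open import Data.Product using (Σ; _×_; _,_)
open import Data.Vec using (lookup; tabulate)
open import Data.Vec.Properties using (lookup∘tabulate; []=⇒lookup; lookup⇒[]=)
open import Relation.Binary.PropositionalEquality
  using (_≡_; refl; sym; trans; cong; subst)

∣p∣≡0⇒x∉p : ∀ {n} {p : Subset n} {x : Fin n} → ∣ p ∣ ≡ 0 → x ∉ p
∣p∣≡0⇒x∉p {n} {p} {x} ∣p∣≡0 x∈p = x∈p⇒x∉∁p x∈p (subst (x ∈_) (sym ∁p≡⊤) ∈⊤)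
  where
  ∁p≡⊤ : ∁ p ≡ ⊤
  ∁p≡⊤ = ∣p∣≡n⇒p≡⊤ (trans (∣∁p∣≡n∸∣p∣ p) (cong (n ∸_) ∣p∣≡0))

x∈tabulate⁺ : ∀ {n} {f : Fin n → Bool} {x : Fin n} → f x ≡ true → x ∈ tabulate f
x∈tabulate⁺ {f = f} {x} fx = lookup⇒[]= x (tabulate f) (trans (lookup∘tabulate f x) fx)

x∈tabulate⁻ : ∀ {n} {f : Fin n → Bool} {x : Fin n} → x ∈ tabulate f → f x ≡ true
x∈tabulate⁻ {f = f} {x} x∈ = trans (sym (lookup∘tabulate f x)) ([]=⇒lookup x∈)

anyFin⁺ : ∀ {n} (p : Fin n → Bool) (x : Fin n) → p x ≡ true → anyFin p ≡ true
anyFin⁺ p zero    px rewrite px = refl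
anyFin⁺ p (suc x) px with p zero
... | true  = refl
... | false = anyFin⁺ (λ y → p (suc y)) x px

module _ {n : ℕ} (G : Digraph n) where

  outDegIn≡0⇒N⁺∩S≡∅ : ∀ {S u w} → outDegIn G S u ≡ 0 → arc G u w ≡ true → w ∉ S
  outDegIn≡0⇒N⁺∩S≡∅ {S} {u} {w} outDeg≡0 u→w w∈S =
    ∣p∣≡0⇒x∉p {p = tabulate (λ y → lookup S y ∧ arc G u y)} outDeg≡0
      (x∈tabulate⁺ (trans (cong (_∧ arc G u w) ([]=⇒lookup w∈S)) u→w))

  path₂⇒∈N⁺⁺ : ∀ {v x w} → arc G v x ≡ true → arc G x w ≡ true → w ∉ N⁺ G v → w ∈ N⁺⁺ G v
  path₂⇒∈N⁺⁺ {v} {x} {w} v→x x→w w∉N⁺ = x∈tabulate⁺ path∧¬arc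
    where
    path : anyFin (λ y → arc G v y ∧ arc G y w) ≡ true
    path = anyFin⁺ _ x (trans (cong (_∧ arc G x w) v→x) x→w)
    ¬v→w : arc G v w ≡ false
    ¬v→w = ¬-not (λ v→w → w∉N⁺ (x∈tabulate⁺ v→w))
    path∧¬arc : anyFin (λ y → arc G v y ∧ arc G y w) ∧ not (arc G v w) ≡ true
    path∧¬arc rewrite path | ¬v→w = refl

  sink⇒N⁺⊆N⁺⁺ : ∀ {v u} → u ∈ N⁺ G v → outDegIn G (N⁺ G v) u ≡ 0 → N⁺ G u ⊆ N⁺⁺ G v
  sink⇒N⁺⊆N⁺⁺ {u = u} u∈N⁺ outDeg≡0 {w} w∈N⁺u =
    path₂⇒∈N⁺⁺ (x∈tabulate⁻ u∈N⁺) u→w (outDegIn≡0⇒N⁺∩S≡∅ outDeg≡0 u→w)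
    where
    u→w : arc G u w ≡ true
    u→w = x∈tabulate⁻ w∈N⁺u

lemma2 : {n : ℕ} (G : Digraph n) (v₀ : Fin n) →
         IsOriented G →
         (∀ v → d⁺ G v₀ ≤ d⁺ G v) →
         d⁺ G v₀ ≡ 3 →
         Σ (Fin n) (λ u → u ∈ N⁺ G v₀ × outDegIn G (N⁺ G v₀) u ≡ 0) →
         ∣ N⁺⁺ G v₀ ∣ ≥ ∣ N⁺ G v₀ ∣
lemma2 G v₀ _ minimal _ (u , u∈N⁺ , sink) =
  ≤-trans (minimal u) (p⊆q⇒∣p∣≤∣q∣ (sink⇒N⁺⊆N⁺⁺ G u∈N⁺ sink))
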